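{- Let $(X,Y,\phi)$ be an $L$-context and $X'\subseteq X$, $Y'\subseteq Y$. The following are equivalent: (i) $S_1$ is an isomorphism of complete $L$-lattices; (ii) $S_2$ is an isomorphism of complete $L$-lattices; (iii) $F_1$ is an isomorphism of complete $L$-lattices; (iv) $F_2$ is an isomorphism of complete $L$-lattices.
   Context: $L=(L,*)$ is a complete residuated lattice: a complete lattice with bottom $0$ and top $1$ with a commutative monoid operation $*$ with unit $1$ satisfying $a*\bigvee_i b_i=\bigvee_i a*b_i$; $\rightarrow$ is its residuum ($a*b\le c\iff a\le b\rightarrow c$). An $L$-context is $(X,Y,\phi)$ with $\phi\colon X\times Y\to L$. $L^X$ is the set of maps $X\to L$ with $L$-order $L^X(\mu,\mu')=\bigwedge_x\mu(x)\rightarrow\mu'(x)$, inherited by subsets. Define $\phi^\exists\colon L^X\to L^Y$, $\phi^\exists(\mu)(y)=\bigvee_x\mu(x)*\phi(x,y)$, $\phi^\forall\colon L^Y\to L^X$, $\phi^\forall(\lambda)(x)=\bigwedge_y\phi(x,y)\rightarrow\lambda(y)$, and $\mathcal K\phi=\{\mu\in L^X:\phi^\forall\phi^\exists\mu=\mu\}$. For $X'\subseteq X,Y'\subseteq Y$, $\phi_{X',Y'}$ is the restriction of $\phi$ to $X'\times Y'$; $\mu_{X'}$ is the restriction of $\mu\in L^X$ to $X'$; for $\mu'\in L^{X'}$, $\underline{\mu'}\in L^X$ extends $\mu'$ by $0$ outside $X'$. The maps are $S_1,S_2\colon\mathcal K\phi\to\mathcal K\phi_{X',Y'}$, $S_1\mu=(\phi_{X',Y'})^\forall(\phi_{X',Y'})^\exists\mu_{X'}$,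 $S_2\mu=((\phi_{X,Y'})^\forall(\phi_{X,Y'})^\exists\mu)_{X'}$, and $F_1,F_2\colon\mathcal K\phi_{X',Y'}\to\mathcal K\phi$, $F_1\mu'=\phi^\forall\phi^\exists\underline{\mu'}$, $F_2\mu'=(\phi_{X,Y'})^\forall(\phi_{X,Y'})^\exists\underline{\mu'}$. An isomorphism of complete $L$-lattices between $P\subseteq L^A$ and $Q\subseteq L^B$ is a bijection $h$ with $L^A(p,p')=L^B(hp,hp')$ for all $p,p'\in P$. -}

module Defs where

open import Data.Product using (Σ; _×_; _,_; proj₁; proj₂)
open import Relation.Binary.PropositionalEquality using (_≡_)
open import Relation.Binary.Structures using (IsPartialOrder)
open import Algebra.Structures using (IsCommutativeMonoid)

-- A complete residuated lattice (L, *), with arbitrary joins/meets indexed by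
-- any type in Set.  Equality of truth values is propositional equality.
record CompleteResiduatedLattice : Set₁ where
  infixl 7 _*_
  infixr 5 _⇒_
  infix 4 _≤_
  field
    Carrier        : Set
    _≤_            : Carrier → Carrier → Set
    isPartialOrder : IsPartialOrder _≡_ _≤_
    ⋁              : {I : Set} → (I → Carrier) → Carrier
    ⋁-upper        : ∀ {I : Set} (f : I → Carrier) (i : I) → f i ≤ ⋁ f
    ⋁-least        : ∀ {I : Set} (f : I → Carrier) (a : Carrier) → (∀ i → f i ≤ a) → ⋁ f ≤ a
    ⋀              : {I : Set} → (I → Carrier) → Carrier
    ⋀-lower        : ∀ {I : Set} (f : I → Carrier) (i : I) → ⋀ f ≤ f i
    ⋀-greatest     : ∀ {I : Set} (f : I → Carrier) (a : Carrier) → (∀ i → a ≤ f i) → a ≤ ⋀ f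
    0#             : Carrier
    1#             : Carrier
    0-bottom       : ∀ a → 0# ≤ a
    1-top          : ∀ a → a ≤ 1#
    _*_            : Carrier → Carrier → Carrier
    *-isCommutativeMonoid : IsCommutativeMonoid _≡_ _*_ 1#
    *-distrib-⋁    : ∀ (a : Carrier) {I : Set} (b : I → Carrier) → a * ⋁ b ≡ ⋁ (λ i → a * b i)
    _⇒_            : Carrier → Carrier → Carrier
    residuation₁   : ∀ a b c → a * b ≤ c → a ≤ b ⇒ c
    residuation₂   : ∀ a b c → a ≤ b ⇒ c → a * b ≤ c

IsSubset : {A : Set} → (A → Set) → Set
IsSubset {A} P = ∀ (a : A) (p q : P a) → p ≡ q

⟦_⟧ : {A : Set} → (A → Set) → Set
⟦_⟧ {A} P = Σ A P

module FCA (𝕃 : CompleteResiduatedLattice) where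
  open CompleteResiduatedLattice 𝕃 public

  Sub : {A : Set} → (A → Carrier) → (A → Carrier) → Carrier
  Sub μ μ' = ⋀ (λ a → μ a ⇒ μ' a)

  _≐_ : {A : Set} → (A → Carrier) → (A → Carrier) → Set
  _≐_ {A} μ μ' = ∀ (a : A) → μ a ≡ μ' a

  module _ {X Y : Set} (φ : X → Y → Carrier) where
    up : (X → Carrier) → (Y → Carrier)
    up μ y = ⋁ (λ x → μ x * φ x y)

    down : (Y → Carrier) → (X → Carrier)
    down λ' x = ⋀ (λ y → φ x y ⇒ λ' y)

    closure : (X → Carrier) → (X → Carrier)
    closure μ = down (up μ)

    𝒦 : (X → Carrier) → Set
    𝒦 μ = closure μ ≐ μ

  -- h : P → Q is an isomorphism of complete L-lattices, where P ⊆ L^A, Q ⊆ L^B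
  -- (h given on all of L^A, considered as restricted to P).
  record IsLIso {A B : Set} (P : (A → Carrier) → Set) (Q : (B → Carrier) → Set)
                (h : (A → Carrier) → (B → Carrier)) : Set where
    field
      maps-into : ∀ p → P p → Q (h p)
      injective : ∀ p p' → P p → P p' → h p ≐ h p' → p ≐ p'
      surjective : ∀ q → Q q → Σ (A → Carrier) (λ p → P p × (h p ≐ q))
      preserves : ∀ p p' → P p → P p' → Sub p p' ≡ Sub (h p) (h p')

  module _ {X Y : Set} (φ : X → Y → Carrier) (X' : X → Set) (Y' : Y → Set) where
    φX'Y' : ⟦ X' ⟧ → ⟦ Y' ⟧ → Carrier
    φX'Y' x y = φ (proj₁ x) (proj₁ y)

    φXY' : X → ⟦ Y' ⟧ → Carrier
    φXY' x y = φ x (proj₁ y)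

    restrict : (X → Carrier) → (⟦ X' ⟧ → Carrier)
    restrict μ x = μ (proj₁ x)

    -- extension by 0 outside X': underline μ' (x) = ⋁_{p : x ∈ X'} μ'(x,p)
    -- (equals μ'(x) when x ∈ X', and the empty join 0 otherwise)
    extend : (⟦ X' ⟧ → Carrier) → (X → Carrier)
    extend μ' x = ⋁ {X' x} (λ p → μ' (x , p))

    S₁ : (X → Carrier) → (⟦ X' ⟧ → Carrier)
    S₁ μ = closure φX'Y' (restrict μ)

    S₂ : (X → Carrier) → (⟦ X' ⟧ → Carrier)
    S₂ μ = restrict (closure φXY' μ)

    F₁ : (⟦ X' ⟧ → Carrier) → (X → Carrier)
    F₁ μ' = closure φ (extend μ')

    F₂ : (⟦ X' ⟧ → Carrier) → (X → Carrier)
    F₂ μ' = closure φXY' (extend μ')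

{-# OPTIONS --safe #-}
-- For closed μ', both F₁μ' and F₂μ' lie between the 0-extension of μ' and
-- its φ_{X,Y'}-closure, and S₁ and S₂ send everything in that range back to
-- μ', because (φ_{X,Y'})^∃ of the 0-extension of μ' is (φ_{X',Y'})^∃ μ'.
-- Hence F₁ and F₂ are right inverses of S₁ and S₂ on 𝒦φ_{X',Y'}, and a map
-- is an isomorphism of complete L-lattices iff a right inverse of it that
-- lands in its domain is one.
module Submission where

open import Defs
open import Data.Product using (_×_; _,_; proj₁; proj₂)
open import Function.Bundles using (_⇔_; mk⇔)
open import Function.Construct.Composition using (_⇔-∘_)
open import Function.Construct.Symmetry using (⇔-sym)
open import Function.Definitions using (Congruent)
open import Relation.Binary.Definitions using (_Respects_)
open import Relation.Binary.PropositionalEquality using (_≡_; sym; trans; cong; cong₂)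
open import Relation.Binary.Structures using (IsPartialOrder)

module _ (𝕃 : CompleteResiduatedLattice) where
  open FCA 𝕃
  open IsPartialOrder isPartialOrder using ()
    renaming (refl to ≤-refl; trans to ≤-trans; antisym to ≤-antisym; reflexive to ≤-reflexive)

  infix 4 _≤̇_

  _≤̇_ : {A : Set} → (A → Carrier) → (A → Carrier) → Set
  μ ≤̇ ν = ∀ a → μ a ≤ ν a

  ≐-sym : {A : Set} {μ ν : A → Carrier} → μ ≐ ν → ν ≐ μ
  ≐-sym e a = sym (e a)

  ≐-trans : {A : Set} {μ ν ρ : A → Carrier} → μ ≐ ν → ν ≐ ρ → μ ≐ ρ
  ≐-trans e e' a = trans (e a) (e' a)

  ≐⇒≤̇ : {A : Set} {μ ν : A → Carrier} → μ ≐ ν → μ ≤̇ ν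
  ≐⇒≤̇ e a = ≤-reflexive (e a)

  ≤̇-trans : {A : Set} {μ ν ρ : A → Carrier} → μ ≤̇ ν → ν ≤̇ ρ → μ ≤̇ ρ
  ≤̇-trans le le' a = ≤-trans (le a) (le' a)

  ≤̇-antisym : {A : Set} {μ ν : A → Carrier} → μ ≤̇ ν → ν ≤̇ μ → μ ≐ ν
  ≤̇-antisym le le' a = ≤-antisym (le a) (le' a)

  ⋁-mono : {I : Set} {f g : I → Carrier} → f ≤̇ g → ⋁ f ≤ ⋁ g
  ⋁-mono {f = f} {g} le = ⋁-least f (⋁ g) (λ i → ≤-trans (le i) (⋁-upper g i))

  ⋀-mono : {I : Set} {f g : I → Carrier} → f ≤̇ g → ⋀ f ≤ ⋀ g
  ⋀-mono {f = f} {g} le = ⋀-greatest g (⋀ f) (λ i → ≤-trans (⋀-lower f i) (le i))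

  ⋁-cong : {I : Set} {f g : I → Carrier} → f ≐ g → ⋁ f ≡ ⋁ g
  ⋁-cong e = ≤-antisym (⋁-mono (≐⇒≤̇ e)) (⋁-mono (≐⇒≤̇ (≐-sym e)))

  ⋀-cong : {I : Set} {f g : I → Carrier} → f ≐ g → ⋀ f ≡ ⋀ g
  ⋀-cong e = ≤-antisym (⋀-mono (≐⇒≤̇ e)) (⋀-mono (≐⇒≤̇ (≐-sym e)))

  ⋀-≤-⋀∘ : {I J : Set} (f : I → Carrier) (k : J → I) → ⋀ f ≤ ⋀ (λ j → f (k j))
  ⋀-≤-⋀∘ f k = ⋀-greatest _ (⋀ f) (λ j → ⋀-lower f (k j))

  ⇒-eval : ∀ a b → (a ⇒ b) * a ≤ b
  ⇒-eval a b = residuation₂ (a ⇒ b) a b ≤-refl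

  *-monoˡ-≤ : ∀ {a b} c → a ≤ b → a * c ≤ b * c
  *-monoˡ-≤ {a} {b} c le = residuation₂ a c (b * c) (≤-trans le (residuation₁ b c (b * c) ≤-refl))

  ⇒-monoʳ-≤ : ∀ {a b} c → a ≤ b → (c ⇒ a) ≤ (c ⇒ b)
  ⇒-monoʳ-≤ {a} {b} c le = residuation₁ (c ⇒ a) c b (≤-trans (⇒-eval c a) le)

  Sub-cong : {A : Set} {μ ν μ' ν' : A → Carrier} → μ ≐ ν → μ' ≐ ν' → Sub μ μ' ≡ Sub ν ν'
  Sub-cong e e' = ⋀-cong (λ a → cong₂ _⇒_ (e a) (e' a))

  module _ {A B : Set} (R : A → B → Carrier) where

    up-mono : {μ ν : A → Carrier} → μ ≤̇ ν → up R μ ≤̇ up R ν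
    up-mono le b = ⋁-mono (λ a → *-monoˡ-≤ (R a b) (le a))

    down-mono : {l l' : B → Carrier} → l ≤̇ l' → down R l ≤̇ down R l'
    down-mono le a = ⋀-mono (λ b → ⇒-monoʳ-≤ (R a b) (le b))

    closure-mono : {μ ν : A → Carrier} → μ ≤̇ ν → closure R μ ≤̇ closure R ν
    closure-mono le = down-mono (up-mono le)

    closure-cong : Congruent _≐_ _≐_ (closure R)
    closure-cong e = ≤̇-antisym (closure-mono (≐⇒≤̇ e)) (closure-mono (≐⇒≤̇ (≐-sym e)))

    closure-extensive : (μ : A → Carrier) → μ ≤̇ closure R μ
    closure-extensive μ a = ⋀-greatest _ (μ a)
      (λ b → residuation₁ (μ a) (R a b) (up R μ b) (⋁-upper (λ a' → μ a' * R a' b) a))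

    up-down-≤ : (l : B → Carrier) → up R (down R l) ≤̇ l
    up-down-≤ l b = ⋁-least _ (l b)
      (λ a → ≤-trans (*-monoˡ-≤ (R a b) (⋀-lower (λ b' → R a b' ⇒ l b') b)) (⇒-eval (R a b) (l b)))

    closure-idempotent : (μ : A → Carrier) → closure R (closure R μ) ≐ closure R μ
    closure-idempotent μ = ≤̇-antisym (down-mono (up-down-≤ (up R μ))) (closure-extensive (closure R μ))

    closure-sandwich : {μ ν : A → Carrier} → μ ≤̇ ν → ν ≤̇ closure R μ → closure R ν ≐ closure R μ
    closure-sandwich {μ} μ≤ν ν≤cμ = ≤̇-antisym
      (≤̇-trans (closure-mono ν≤cμ) (≐⇒≤̇ (closure-idempotent μ)))
      (closure-mono μ≤ν)

    𝒦-respects-≐ : 𝒦 R Respects _≐_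
    𝒦-respects-≐ e k = ≐-trans (closure-cong (≐-sym e)) (≐-trans k e)

  IsLIso-rightInverse : {A B : Set} {P : (A → Carrier) → Set} {Q : (B → Carrier) → Set}
                      {h : (A → Carrier) → (B → Carrier)} {g : (B → Carrier) → (A → Carrier)} →
                      IsLIso P Q h → Congruent _≐_ _≐_ h →
                      (∀ q → Q q → P (g q)) → (∀ q → Q q → h (g q) ≐ q) → IsLIso Q P g
  IsLIso-rightInverse {P = P} {h = h} {g} h-iso h-cong g-into hg = record
    { maps-into  = g-into
    ; injective  = λ q q' Qq Qq' e → ≐-trans (≐-sym (hg q Qq)) (≐-trans (h-cong e) (hg q' Qq'))
    ; surjective = λ p Pp → h p , maps-into p Pp , gh p Pp
    ; preserves  = λ q q' Qq Qq' → trans (Sub-cong (≐-sym (hg q Qq)) (≐-sym (hg q' Qq')))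
                                         (sym (preserves (g q) (g q') (g-into q Qq) (g-into q' Qq')))
    }
    where
    open IsLIso h-iso
    gh : ∀ p → P p → g (h p) ≐ p
    gh p Pp = injective (g (h p)) p (g-into (h p) (maps-into p Pp)) Pp (hg (h p) (maps-into p Pp))

  module _ {A B : Set} {P : (A → Carrier) → Set} {Q : (B → Carrier) → Set}
           {h : (A → Carrier) → (B → Carrier)} {g : (B → Carrier) → (A → Carrier)} where

    IsLIso-leftInverse-isInverse : IsLIso Q P g → Congruent _≐_ _≐_ h → Congruent _≐_ _≐_ g → Q Respects _≐_ →
                         (∀ q → Q q → h (g q) ≐ q) → (∀ p → P p → Q (h p)) × (∀ p → P p → g (h p) ≐ p)
    IsLIso-leftInverse-isInverse g-iso h-cong g-cong Q-resp hg = h-into , gh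
      where
      open IsLIso g-iso
      hp≐q : ∀ p (Pp : P p) → h p ≐ proj₁ (surjective p Pp)
      hp≐q p Pp with surjective p Pp
      ... | q , Qq , gq≐p = ≐-trans (h-cong (≐-sym gq≐p)) (hg q Qq)
      h-into : ∀ p → P p → Q (h p)
      h-into p Pp = Q-resp (≐-sym (hp≐q p Pp)) (proj₁ (proj₂ (surjective p Pp)))
      gh : ∀ p → P p → g (h p) ≐ p
      gh p Pp = ≐-trans (g-cong (hp≐q p Pp)) (proj₂ (proj₂ (surjective p Pp)))

    IsLIso⇔IsLIso-rightInverse : Congruent _≐_ _≐_ h → Congruent _≐_ _≐_ g → Q Respects _≐_ →
                                 (∀ q → Q q → P (g q)) → (∀ q → Q q → h (g q) ≐ q) →
                                 IsLIso P Q h ⇔ IsLIso Q P g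
    IsLIso⇔IsLIso-rightInverse h-cong g-cong Q-resp g-into hg = mk⇔
      (λ h-iso → IsLIso-rightInverse h-iso h-cong g-into hg)
      (λ g-iso → let h-into , gh = IsLIso-leftInverse-isInverse g-iso h-cong g-cong Q-resp hg
                 in IsLIso-rightInverse g-iso g-cong h-into gh)

  module Restriction {X Y : Set} (φ : X → Y → Carrier) (X' : X → Set) (Y' : Y → Set)
                     (X'-isSubset : IsSubset X') where

    ψ : ⟦ X' ⟧ → ⟦ Y' ⟧ → Carrier
    ψ = φX'Y' φ X' Y'

    χ : X → ⟦ Y' ⟧ → Carrier
    χ = φXY' φ X' Y'

    restrict-extend : (μ' : ⟦ X' ⟧ → Carrier) → restrict φ X' Y' (extend φ X' Y' μ') ≐ μ'
    restrict-extend μ' (x , p) = ≤-antisym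
      (⋁-least _ (μ' (x , p)) (λ q → ≤-reflexive (cong (λ r → μ' (x , r)) (X'-isSubset x q p))))
      (⋁-upper (λ q → μ' (x , q)) p)

    up-extend : (μ' : ⟦ X' ⟧ → Carrier) → up χ (extend φ X' Y' μ') ≐ up ψ μ'
    up-extend μ' (y , _) = ≤-antisym
      (⋁-least _ _ (λ x → residuation₂ _ _ _ (⋁-least _ _ (λ p → residuation₁ _ _ _
        (⋁-upper (λ x' → μ' x' * φ (proj₁ x') y) (x , p))))))
      (⋁-least _ _ (λ { (x , p) → ≤-trans (*-monoˡ-≤ (φ x y) (⋁-upper (λ q → μ' (x , q)) p))
        (⋁-upper (λ x' → extend φ X' Y' μ' x' * φ x' y) x) }))

    -- restrict ∘ down χ is down ψ on the nose.
    restrict-closure-extend : (μ' : ⟦ X' ⟧ → Carrier) →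
                              restrict φ X' Y' (closure χ (extend φ X' Y' μ')) ≐ closure ψ μ'
    restrict-closure-extend μ' (x , _) = ⋀-cong (λ y → cong (φ x (proj₁ y) ⇒_) (up-extend μ' y))

    closure≤closure-χ : (ν : X → Carrier) → closure φ ν ≤̇ closure χ ν
    closure≤closure-χ ν x = ⋀-≤-⋀∘ (λ y → φ x y ⇒ up φ ν y) proj₁

    𝒦-χ⇒𝒦 : {μ : X → Carrier} → 𝒦 χ μ → 𝒦 φ μ
    𝒦-χ⇒𝒦 {μ} k = ≤̇-antisym
      (≤̇-trans (closure≤closure-χ μ) (≐⇒≤̇ k))
      (closure-extensive φ μ)

    Between : (⟦ X' ⟧ → Carrier) → (X → Carrier) → Set
    Between μ' m = extend φ X' Y' μ' ≤̇ m × m ≤̇ closure χ (extend φ X' Y' μ')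

    restrict-between : {μ' : ⟦ X' ⟧ → Carrier} {m : X → Carrier} → 𝒦 ψ μ' → Between μ' m →
                       restrict φ X' Y' m ≐ μ'
    restrict-between {μ'} k (lower , upper) = ≤̇-antisym
      (λ { (x , p) → ≤-trans (upper x) (≤-reflexive (trans (restrict-closure-extend μ' (x , p)) (k (x , p)))) })
      (λ { (x , p) → ≤-trans (≤-reflexive (sym (restrict-extend μ' (x , p)))) (lower x) })

    S₁-between : {μ' : ⟦ X' ⟧ → Carrier} {m : X → Carrier} → 𝒦 ψ μ' → Between μ' m → S₁ φ X' Y' m ≐ μ'
    S₁-between k b = ≐-trans (closure-cong ψ (restrict-between k b)) k

    S₂-between : {μ' : ⟦ X' ⟧ → Carrier} {m : X → Carrier} → 𝒦 ψ μ' → Between μ' m → S₂ φ X' Y' m ≐ μ'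
    S₂-between {μ'} k (lower , upper) (x , p) =
      trans (closure-sandwich χ lower upper x) (trans (restrict-closure-extend μ' (x , p)) (k (x , p)))

    F₁-between : (μ' : ⟦ X' ⟧ → Carrier) → Between μ' (F₁ φ X' Y' μ')
    F₁-between μ' = closure-extensive φ _ , closure≤closure-χ _

    F₂-between : (μ' : ⟦ X' ⟧ → Carrier) → Between μ' (F₂ φ X' Y' μ')
    F₂-between μ' = closure-extensive χ _ , λ _ → ≤-refl

    extend-cong : Congruent _≐_ _≐_ (extend φ X' Y')
    extend-cong e x = ⋁-cong (λ p → e (x , p))

    S₁-cong : Congruent _≐_ _≐_ (S₁ φ X' Y')
    S₁-cong e = closure-cong ψ (λ { (x , _) → e x })

    S₂-cong : Congruent _≐_ _≐_ (S₂ φ X' Y')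
    S₂-cong e (x , _) = closure-cong χ e x

    F₁-cong : Congruent _≐_ _≐_ (F₁ φ X' Y')
    F₁-cong e = closure-cong φ (extend-cong e)

    F₂-cong : Congruent _≐_ _≐_ (F₂ φ X' Y')
    F₂-cong e = closure-cong χ (extend-cong e)

    F₁-into : ∀ μ' → 𝒦 ψ μ' → 𝒦 φ (F₁ φ X' Y' μ')
    F₁-into μ' _ = closure-idempotent φ (extend φ X' Y' μ')

    F₂-into : ∀ μ' → 𝒦 ψ μ' → 𝒦 φ (F₂ φ X' Y' μ')
    F₂-into μ' _ = 𝒦-χ⇒𝒦 (closure-idempotent χ (extend φ X' Y' μ'))

    S₁-iso⇔F₁-iso : IsLIso (𝒦 φ) (𝒦 ψ) (S₁ φ X' Y') ⇔ IsLIso (𝒦 ψ) (𝒦 φ) (F₁ φ X' Y')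
    S₁-iso⇔F₁-iso = IsLIso⇔IsLIso-rightInverse S₁-cong F₁-cong (𝒦-respects-≐ ψ) F₁-into
      (λ μ' k → S₁-between k (F₁-between μ'))

    S₂-iso⇔F₁-iso : IsLIso (𝒦 φ) (𝒦 ψ) (S₂ φ X' Y') ⇔ IsLIso (𝒦 ψ) (𝒦 φ) (F₁ φ X' Y')
    S₂-iso⇔F₁-iso = IsLIso⇔IsLIso-rightInverse S₂-cong F₁-cong (𝒦-respects-≐ ψ) F₁-into
      (λ μ' k → S₂-between k (F₁-between μ'))

    S₁-iso⇔F₂-iso : IsLIso (𝒦 φ) (𝒦 ψ) (S₁ φ X' Y') ⇔ IsLIso (𝒦 ψ) (𝒦 φ) (F₂ φ X' Y')
    S₁-iso⇔F₂-iso = IsLIso⇔IsLIso-rightInverse S₁-cong F₂-cong (𝒦-respects-≐ ψ) F₂-into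
      (λ μ' k → S₁-between k (F₂-between μ'))

theorem4p4 : (𝕃 : CompleteResiduatedLattice) →
    let open FCA 𝕃 in
    {X Y : Set} (φ : X → Y → Carrier) (X' : X → Set) (Y' : Y → Set) →
    IsSubset X' → IsSubset Y' →
    (IsLIso (𝒦 φ) (𝒦 (φX'Y' φ X' Y')) (S₁ φ X' Y') ⇔ IsLIso (𝒦 φ) (𝒦 (φX'Y' φ X' Y')) (S₂ φ X' Y'))
    × (IsLIso (𝒦 φ) (𝒦 (φX'Y' φ X' Y')) (S₁ φ X' Y') ⇔ IsLIso (𝒦 (φX'Y' φ X' Y')) (𝒦 φ) (F₁ φ X' Y'))
    × (IsLIso (𝒦 φ) (𝒦 (φX'Y' φ X' Y')) (S₁ φ X' Y') ⇔ IsLIso (𝒦 (φX'Y' φ X' Y')) (𝒦 φ) (F₂ φ X' Y'))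
theorem4p4 𝕃 φ X' Y' X'-isSubset _ =
  ⇔-sym S₂-iso⇔F₁-iso ⇔-∘ S₁-iso⇔F₁-iso , S₁-iso⇔F₁-iso , S₁-iso⇔F₂-iso
  where open Restriction 𝕃 φ X' Y' X'-isSubset
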